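{- Let $s \ge 6$ and let $G$ be the graph constructed as follows. Let $B_1=\{a_1,\dots,a_s\}$, $B_2=\{b_1,\dots,b_s\}$ and $B_3=\{z_{i,j} : \{i,j\}\text{ a 2-element subset of }\{1,\dots,s\}\}$ be disjoint vertex sets (so $z_{i,j}=z_{j,i}$ and $|B_3|=\binom{s}{2}$), and let $x$ be a further vertex. Make $B_1$ and $B_2$ cliques; join $a_i$ to $b_j$ for all $i\ne j$ (and $a_ib_i$ is not an edge); join $x$ to every vertex of $B_3$; join $b_i$ to $z_{j,\ell}$ whenever $i,j,\ell$ are pairwise distinct; join $a_i$ to $z_{i,j}$ for all $j\ne i$; there are no other edges. Then: (1) $G$ is $4$-$\gamma_c$-critical, has no cut-vertex, and is not traceable; and (2) with $H=G[B_2]$, the graph $G$ belongs to $\mathcal{P}(4)$, i.e. $H$ is a maximal complete subgraph of $G$ of order at least $2$ such that (a) every vertex of $G$ belongs to some minimum connected dominating set of $G$ that contains a vertex of $H$, and (b) for every pair of non-adjacent vertices $u,v$ of $G$ there is a connected dominating set $D'_{uv}$ of $G+uv$ with $D'_{uv}\cap V(H)\neq\emptyset$ and $|D'_{uv}|<4$.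
   Context: Graphs are finite and simple. For a connected graph $G$, a connected dominating set is a set $S\subseteq V(G)$ such that every vertex outside $S$ has a neighbor in $S$ and $G[S]$ is connected; $\gamma_c(G)$ is the minimum size of such a set. A connected graph $G$ is $k$-$\gamma_c$-critical if $\gamma_c(G)=k$ and $\gamma_c(G+uv)<k$ for every pair of non-adjacent vertices $u,v$. For $k\ge3$, $\mathcal{P}(k)$ is the class of $k$-$\gamma_c$-critical graphs $G$ having a maximal complete subgraph $H$ of order at least $2$ satisfying (a) every vertex of $G$ belongs to some $\gamma_c$-set of $G$ containing a vertex of $H$, and (b) for every pair of non-adjacent vertices $u,v$ of $G$ there is a connected dominating set $D'$ of $G+uv$ with $D'\cap V(H)\ne\emptyset$ and $|D'|<k$. A graph is traceable if it has a hamiltonian path. -}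

module Defs where

open import Data.Nat using (ℕ; _≤_; _<_)
open import Data.Fin using (Fin) renaming (_<_ to _<ᶠ_)
open import Data.List using (List; length; _∷_; [])
open import Data.List.Membership.Propositional using (_∈_)
open import Data.List.Relation.Unary.Unique.Propositional using (Unique)
open import Data.Product using (Σ; ∃; _×_; _,_)
open import Data.Sum using (_⊎_)
open import Data.Unit using (⊤)
open import Data.Empty using (⊥)
open import Relation.Nullary using (¬_)
open import Relation.Binary.PropositionalEquality using (_≡_; _≢_)

-- Generic notions for a (simple) graph given by a vertex type V and an
-- adjacency relation E. Vertex sets are duplicate-free lists (size = length).

module _ {V : Set} (E : V → V → Set) where

  data Walk (P : V → Set) : V → V → Set where
    here : ∀ {u} → P u → Walk P u u
    step : ∀ {u w v} → P u → E u w → Walk P w v → Walk P u v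

  Connected : Set
  Connected = ∀ u v → Walk (λ _ → ⊤) u v

  IsCDS : List V → Set
  IsCDS S = Unique S
          × (∀ v → v ∈ S ⊎ Σ V (λ u → u ∈ S × E v u))
          × (∀ u v → u ∈ S → v ∈ S → Walk (_∈ S) u v)

  GammaC : ℕ → Set
  GammaC k = Σ (List V) (λ S → IsCDS S × length S ≡ k)
           × (∀ S → IsCDS S → k ≤ length S)

  IsGammaCSet : ℕ → List V → Set
  IsGammaCSet k S = IsCDS S × length S ≡ k

  NonAdjPair : V → V → Set
  NonAdjPair u v = u ≢ v × ¬ E u v

  HasCutVertex : Set
  HasCutVertex = Σ V (λ w → ¬ (∀ u v → u ≢ w → v ≢ w → Walk (λ y → y ≢ w) u v))

  data Consec : List V → Set where
    c0 : Consec []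
    c1 : ∀ {u} → Consec (u ∷ [])
    c2 : ∀ {u w l} → E u w → Consec (w ∷ l) → Consec (u ∷ w ∷ l)

  Traceable : Set
  Traceable = Σ (List V) (λ L → Unique L × (∀ v → v ∈ L) × Consec L)

  IsClique : (V → Set) → Set
  IsClique P = ∀ u v → P u → P v → u ≢ v → E u v

  IsMaxClique : (V → Set) → Set₁
  IsMaxClique P = IsClique P × (∀ Q → IsClique Q → (∀ v → P v → Q v) → ∀ v → Q v → P v)

AddEdge : {V : Set} → (V → V → Set) → V → V → (V → V → Set)
AddEdge E u v p q = E p q ⊎ (p ≡ u × q ≡ v) ⊎ (p ≡ v × q ≡ u)

Critical : {V : Set} → (V → V → Set) → ℕ → Set
Critical E k = Connected E × GammaC E k
  × (∀ u v → NonAdjPair E u v →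
       Σ _ (λ S → IsCDS (AddEdge E u v) S × length S < k))

InP : {V : Set} → (V → V → Set) → ℕ → (V → Set) → Set₁
InP {V} E k H = Critical E k
  × IsMaxClique E H
  × Σ V (λ h₁ → Σ V (λ h₂ → H h₁ × H h₂ × h₁ ≢ h₂))
  × (∀ v → Σ (List V) (λ S → IsGammaCSet E k S × v ∈ S
                          × Σ V (λ h → h ∈ S × H h)))
  × (∀ u v → NonAdjPair E u v →
       Σ (List V) (λ D → IsCDS (AddEdge E u v) D
                          × Σ V (λ h → h ∈ D × H h) × length D < k))

data Vtx (s : ℕ) : Set where
  a : Fin s → Vtx s
  b : Fin s → Vtx s
  z : (i j : Fin s) → .(i <ᶠ j) → Vtx s   -- z_{i,j} = z_{j,i}, stored with i < j
  x : Vtx s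

Adj : (s : ℕ) → Vtx s → Vtx s → Set
Adj s (a i) (a j) = i ≢ j
Adj s (b i) (b j) = i ≢ j
Adj s (a i) (b j) = i ≢ j
Adj s (b i) (a j) = i ≢ j
Adj s x (z _ _ _) = ⊤
Adj s (z _ _ _) x = ⊤
Adj s (b i) (z j l _) = i ≢ j × i ≢ l
Adj s (z j l _) (b i) = i ≢ j × i ≢ l
Adj s (a i) (z j l _) = i ≡ j ⊎ i ≡ l
Adj s (z j l _) (a i) = i ≡ j ⊎ i ≡ l
Adj s _ _ = ⊥

IsB2 : (s : ℕ) → Vtx s → Set
IsB2 s (b _) = ⊤
IsB2 s _ = ⊥

-- The vertex x is dominated only by itself and by B₃, so a connected dominating set contains x or
-- some z_{i,j}; for a set of at most three vertices every case leaves undominated a vertex built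
-- from indices the set does not use, of which s ≥ 6 leaves enough. Hence γ_c ≥ 4, while
-- {x, z_{i,j}, a_i, b_k} with k ≠ i is a connected dominating set meeting B₂, and such sets pass
-- through every vertex. After adding a missing edge uv, one of the paths b_i z x, b_j b_i z or
-- a_i b_j b_i dominates. B₃ is independent, so on a hamiltonian path its C(s,2) ≥ 2s+3 vertices
-- would need 2s+2 separating vertices outside B₃, but only 2s+1 vertices lie outside it. Finally,
-- every vertex other than w reaches b_c, for an index c not used by w, while avoiding w.

module Submission where

open import Defs
open import Data.Nat as ℕ using (ℕ; zero; suc; _≤_; _<_; z≤n; s≤s; _+_)
import Data.Nat.Properties as ℕP
open import Data.Fin as F using (Fin) renaming (_<_ to _<ᶠ_)
import Data.Fin.Properties as FP
open import Data.List using (List; []; _∷_; length; filter; map; _++_; allFin; lookup)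
import Data.List.Properties as LP
open import Data.List.Membership.Propositional using (_∈_; _∉_)
import Data.List.Membership.DecPropositional as DecMembership
open import Data.List.Membership.Propositional.Properties
  using (∈-map⁺; ∈-map⁻; ∈-filter⁺; ∈-filter⁻; ∈-++⁺ˡ; ∈-++⁺ʳ; ∈-++⁻; ∈-allFin)
open import Data.List.Relation.Unary.Any as Any using (here; there)
open import Data.List.Relation.Unary.Any.Properties using (lookup-index)
open import Data.List.Relation.Unary.All as All using ([]; _∷_)
open import Data.List.Relation.Unary.AllPairs using ([]; _∷_)
open import Data.List.Relation.Unary.Unique.Propositional using (Unique)
import Data.List.Relation.Unary.Unique.Propositional.Properties as Unique
open import Data.Product as Product using (Σ; ∃; _×_; _,_; proj₁; proj₂)
open import Data.Sum as Sum using (_⊎_; inj₁; inj₂; [_,_]) renaming (swap to ⊎-swap)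
open import Data.Unit using (⊤; tt)
open import Data.Empty using (⊥; ⊥-elim)
open import Function using (_∘_; id)
open import Relation.Nullary using (¬_; yes; no; ¬?)
open import Relation.Nullary.Decidable using (True; toWitness; fromWitness; recompute; decidable-stable)
open import Relation.Unary using (Decidable)
open import Relation.Binary.PropositionalEquality hiding ([_])
open import Relation.Binary.Definitions using (tri<; tri≈; tri>)

module _ {A : Set} where

  ∈₀ : ∀ {p : A} {L} → p ∈ p ∷ L
  ∈₀ = here refl

  ∈₁ : ∀ {p q : A} {L} → q ∈ p ∷ q ∷ L
  ∈₁ = there ∈₀

  ∈₂ : ∀ {p q r : A} {L} → r ∈ p ∷ q ∷ r ∷ L
  ∈₂ = there ∈₁

  ∈₃ : ∀ {p q r t : A} {L} → t ∈ p ∷ q ∷ r ∷ t ∷ L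
  ∈₃ = there ∈₂

  ∉⇒≢ : ∀ {k i : A} {L} → k ∉ L → i ∈ L → k ≢ i
  ∉⇒≢ k∉L i∈L refl = k∉L i∈L

Fin-∃∉ : ∀ {n} (L : List (Fin n)) → length L < n → ∃ λ k → k ∉ L
Fin-∃∉ {n} L |L|<n = FP.¬∀⟶∃¬ n (_∈ L) (_∈? L) not-all
  where
  open DecMembership (FP._≟_ {n}) using (_∈?_)
  not-all : ¬ (∀ k → k ∈ L)
  not-all all with FP.pigeonhole |L|<n (λ k → Any.index (all k))
  ... | i , j , i<j , same-index = FP.<-irrefl i≡j i<j
    where
    i≡j : i ≡ j
    i≡j = trans (lookup-index (all i)) (trans (cong (lookup L) same-index) (sym (lookup-index (all j))))

∈-─ : ∀ {A : Set} {w v : A} (ys : List A) (w∈ys : w ∈ ys) → v ∈ ys → v ≢ w → v ∈ (ys Any.─ w∈ys)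
∈-─ (y ∷ ys) (here refl) (here refl) v≢w = ⊥-elim (v≢w refl)
∈-─ (y ∷ ys) (here refl) (there v∈ys) v≢w = v∈ys
∈-─ (y ∷ ys) (there w∈ys) (here refl) v≢w = here refl
∈-─ (y ∷ ys) (there w∈ys) (there v∈ys) v≢w = there (∈-─ ys w∈ys v∈ys v≢w)

Unique-length-≤ : ∀ {A : Set} {xs ys : List A} → Unique xs → (∀ {v} → v ∈ xs → v ∈ ys) → length xs ≤ length ys
Unique-length-≤ {xs = []} _ _ = z≤n
Unique-length-≤ {xs = w ∷ xs} {ys} (w∉xs ∷ unique) xs⊆ys =
  subst (suc (length xs) ≤_) (sym (LP.length-removeAt′ ys (Any.index w∈ys)))
    (s≤s (Unique-length-≤ unique λ v∈xs → ∈-─ ys w∈ys (xs⊆ys (there v∈xs)) (All.lookup w∉xs v∈xs ∘ sym)))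
  where
  w∈ys : w ∈ ys
  w∈ys = xs⊆ys (here refl)

module _ {A B C : Set} where

  ⊎₃-swap₁₂ : A ⊎ B ⊎ C → B ⊎ A ⊎ C
  ⊎₃-swap₁₂ = [ inj₂ ∘ inj₁ , [ inj₁ , inj₂ ∘ inj₂ ] ]

  ⊎₃-swap₂₃ : A ⊎ B ⊎ C → A ⊎ C ⊎ B
  ⊎₃-swap₂₃ = [ inj₁ , inj₂ ∘ ⊎-swap ]

  ⊎₃-swap₁₃ : A ⊎ B ⊎ C → C ⊎ B ⊎ A
  ⊎₃-swap₁₃ = [ inj₂ ∘ inj₂ , [ inj₂ ∘ inj₁ , inj₁ ] ]

Dominates : ∀ {V : Set} → (V → V → Set) → List V → Set
Dominates {V} E S = ∀ v → v ∈ S ⊎ Σ V λ u → u ∈ S × E v u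

module WalkProperties {V : Set} {E : V → V → Set} where

  head : ∀ {P u v} → Walk E P u v → P u
  head (here p) = p
  head (step p _ _) = p

  infixr 5 _++ʷ_
  _++ʷ_ : ∀ {P u v w} → Walk E P u v → Walk E P v w → Walk E P u w
  here _ ++ʷ walk = walk
  step p e walk ++ʷ walk′ = step p e (walk ++ʷ walk′)

  map-Walk : ∀ {P Q : V → Set} → (∀ {v} → P v → Q v) → ∀ {u v} → Walk E P u v → Walk E Q u v
  map-Walk f (here p) = here (f p)
  map-Walk f (step p e walk) = step (f p) e (map-Walk f walk)

  first-step : ∀ {P u v} → Walk E P u v → u ≢ v → ∃ λ w → P w × E u w
  first-step (here _) u≢u = ⊥-elim (u≢u refl)
  first-step (step _ e walk) _ = _ , head walk , e

  module _ (E-sym : ∀ {u v} → E u v → E v u) where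

    reverse : ∀ {P u v} → Walk E P u v → Walk E P v u
    reverse (here p) = here p
    reverse (step p e walk) = reverse walk ++ʷ step (head walk) (E-sym e) (here p)

    Consec⇒Walk-to-head : ∀ {h u L} → Consec E (h ∷ L) → u ∈ h ∷ L → Walk E (_∈ h ∷ L) u h
    Consec⇒Walk-to-head c1 (here refl) = here (here refl)
    Consec⇒Walk-to-head (c2 _ _) (here refl) = here (here refl)
    Consec⇒Walk-to-head (c2 e path) (there u∈L) =
      map-Walk there (Consec⇒Walk-to-head path u∈L) ++ʷ step (there (here refl)) (E-sym e) (here (here refl))

    Consec⇒Walk : ∀ {L u v} → Consec E L → u ∈ L → v ∈ L → Walk E (_∈ L) u v
    Consec⇒Walk {_ ∷ _} path u∈L v∈L = Consec⇒Walk-to-head path u∈L ++ʷ reverse (Consec⇒Walk-to-head path v∈L)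

    Consec⇒IsCDS : ∀ {S} → Unique S → Consec E S → Dominates E S → IsCDS E S
    Consec⇒IsCDS unique path dominating = unique , dominating , λ _ _ → Consec⇒Walk path

AddEdge-sym : ∀ {V : Set} {E : V → V → Set} → (∀ {p q} → E p q → E q p) →
              ∀ {u v p q} → AddEdge E u v p q → AddEdge E u v q p
AddEdge-sym E-sym (inj₁ e) = inj₁ (E-sym e)
AddEdge-sym E-sym (inj₂ (inj₁ (refl , refl))) = inj₂ (inj₂ (refl , refl))
AddEdge-sym E-sym (inj₂ (inj₂ (refl , refl))) = inj₂ (inj₁ (refl , refl))

module _ {V : Set} {E : V → V → Set} {P : V → Set} (P? : Decidable P)
         (P-independent : ∀ {u v} → P u → E u v → ¬ P v) where

  mutual
    Consec⇒independent≤1+rest : ∀ {L} → Consec E L → length (filter P? L) ≤ suc (length (filter (¬? ∘ P?) L))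
    Consec⇒independent≤1+rest c0 = z≤n
    Consec⇒independent≤1+rest (c1 {u}) with P? u
    ... | yes _ = s≤s z≤n
    ... | no _ = z≤n
    Consec⇒independent≤1+rest (c2 {u} e path) with P? u
    ... | yes pu = s≤s (Consec⇒independent≤rest (P-independent pu e) path)
    ... | no _ = ℕP.m≤n⇒m≤1+n (Consec⇒independent≤1+rest path)

    Consec⇒independent≤rest : ∀ {u L} → ¬ P u → Consec E (u ∷ L) → length (filter P? (u ∷ L)) ≤ length (filter (¬? ∘ P?) (u ∷ L))
    Consec⇒independent≤rest {u} ¬pu path with P? u
    ... | yes pu = ⊥-elim (¬pu pu)
    Consec⇒independent≤rest ¬pu c1 | no _ = z≤n
    Consec⇒independent≤rest ¬pu (c2 _ path) | no _ = Consec⇒independent≤1+rest path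

ordered-pairs : (n : ℕ) → List (Fin n × Fin n)
ordered-pairs zero = []
ordered-pairs (suc n) = map (λ j → F.zero , F.suc j) (allFin n) ++ map (λ (i , j) → F.suc i , F.suc j) (ordered-pairs n)

length-ordered-pairs-suc : ∀ n → length (ordered-pairs (suc n)) ≡ n + length (ordered-pairs n)
length-ordered-pairs-suc n = begin
  length (first-row ++ shifted)        ≡⟨ LP.length-++ first-row ⟩
  length first-row + length shifted    ≡⟨ cong₂ _+_ (trans (LP.length-map _ (allFin n)) (LP.length-tabulate (λ i → i)))
                                                    (LP.length-map _ (ordered-pairs n)) ⟩
  n + length (ordered-pairs n)         ∎
  where
  open ≡-Reasoning
  first-row : List (Fin (suc n) × Fin (suc n))
  first-row = map (λ j → F.zero , F.suc j) (allFin n)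
  shifted : List (Fin (suc n) × Fin (suc n))
  shifted = map (λ (i , j) → F.suc i , F.suc j) (ordered-pairs n)

ordered-pairs-< : ∀ {n i j} → (i , j) ∈ ordered-pairs n → i <ᶠ j
ordered-pairs-< {suc n} p∈ with ∈-++⁻ (map (λ j → F.zero , F.suc j) (allFin n)) p∈
... | inj₁ p∈first-row with ∈-map⁻ (λ j → F.zero , F.suc j) p∈first-row
...   | _ , _ , refl = s≤s z≤n
ordered-pairs-< {suc n} p∈ | inj₂ p∈shifted with ∈-map⁻ (λ (i , j) → F.suc i , F.suc j) p∈shifted
...   | _ , q∈ , refl = s≤s (ordered-pairs-< q∈)

ordered-pairs-Unique : ∀ n → Unique (ordered-pairs n)
ordered-pairs-Unique zero = []
ordered-pairs-Unique (suc n) =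
  Unique.++⁺ (Unique.map⁺ first-injective (Unique.allFin⁺ n)) (Unique.map⁺ shift-injective (ordered-pairs-Unique n)) disjoint
  where
  first-injective : ∀ {j k : Fin n} → (F.zero {n} , F.suc j) ≡ (F.zero , F.suc k) → j ≡ k
  first-injective refl = refl
  shift-injective : ∀ {p q : Fin n × Fin n} → (F.suc (proj₁ p) , F.suc (proj₂ p)) ≡ (F.suc (proj₁ q) , F.suc (proj₂ q)) → p ≡ q
  shift-injective refl = refl
  disjoint : ∀ {p} → ¬ (p ∈ map (λ j → F.zero , F.suc j) (allFin n) × p ∈ map (λ (i , j) → F.suc i , F.suc j) (ordered-pairs n))
  disjoint (p∈first-row , p∈shifted) with ∈-map⁻ (λ j → F.zero {n} , F.suc j) p∈first-row | ∈-map⁻ (λ (i , j) → F.suc i , F.suc j) p∈shifted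
  ... | _ , _ , refl | _ , _ , ()

2n+3≤length-ordered-pairs : ∀ {n} → 6 ≤ n → 3 + (n + n) ≤ length (ordered-pairs n)
2n+3≤length-ordered-pairs 6≤n = go (ℕP.≤⇒≤′ 6≤n)
  where
  go : ∀ {n} → 6 ℕ.≤′ n → 3 + (n + n) ≤ length (ordered-pairs n)
  go ℕ.≤′-refl = ℕP.≤-refl
  go {suc n} (ℕ.≤′-step 6≤′n) = begin
    3 + (suc n + suc n)          ≡⟨ cong (3 +_) (cong suc (ℕP.+-suc n n)) ⟩
    2 + (3 + (n + n))            ≤⟨ ℕP.+-monoˡ-≤ (3 + (n + n)) (ℕP.≤-trans (s≤s (s≤s z≤n)) (ℕP.≤′⇒≤ 6≤′n)) ⟩
    n + (3 + (n + n))            ≤⟨ ℕP.+-monoʳ-≤ n (go 6≤′n) ⟩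
    n + length (ordered-pairs n) ≡⟨ sym (length-ordered-pairs-suc n) ⟩
    length (ordered-pairs (suc n)) ∎
    where open ℕP.≤-Reasoning

module Construction (s : ℕ) (6≤s : 6 ≤ s) where

  open WalkProperties

  V : Set
  V = Vtx s

  E : V → V → Set
  E = Adj s

  -- Opaque so that unification never unfolds the pigeonhole search behind it.
  opaque
    fresh : (L : List (Fin s)) → {True (length L ℕ.≤? 5)} → ∃ λ k → k ∉ L
    fresh L {|L|≤5} = Fin-∃∉ L (ℕP.≤-trans (s≤s (toWitness |L|≤5)) 6≤s)

  ∉⇒¬incident : ∀ {k i j : Fin s} {L} → k ∉ L → i ∈ L → j ∈ L → ¬ (k ≡ i ⊎ k ≡ j)
  ∉⇒¬incident k∉L i∈L j∈L = [ ∉⇒≢ k∉L i∈L , ∉⇒≢ k∉L j∈L ]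

  ∉⇒¬incident′ : ∀ {m c d : Fin s} {L} → c ∉ L → d ∉ L → m ∈ L → ¬ (m ≡ c ⊎ m ≡ d)
  ∉⇒¬incident′ c∉L d∉L m∈L = [ ∉⇒≢ c∉L m∈L ∘ sym , ∉⇒≢ d∉L m∈L ∘ sym ]

  index₀ : Fin s
  index₀ = proj₁ (fresh [])

  recompute-< : ∀ {i j : Fin s} → .(i <ᶠ j) → i <ᶠ j
  recompute-< {i} {j} i<j = recompute (i F.<? j) i<j

  <⇒≢ : ∀ {i j : Fin s} → .(i <ᶠ j) → i ≢ j
  <⇒≢ i<j = FP.<⇒≢ (recompute-< i<j)

  z-injective : ∀ {i j k l} .{i<j : i <ᶠ j} .{k<l : k <ᶠ l} → z {s} i j i<j ≡ z k l k<l → i ≡ k × j ≡ l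
  z-injective refl = refl , refl

  b-injective : ∀ {i j : Fin s} → b i ≡ b j → i ≡ j
  b-injective refl = refl

  z-≡ : ∀ {i j k l} → (i<j : i <ᶠ j) → (k<l : k <ᶠ l) → i ≡ k ⊎ i ≡ l → j ≡ k ⊎ j ≡ l → z {s} i j i<j ≡ z k l k<l
  z-≡ i<i _ (inj₁ refl) (inj₁ refl) = ⊥-elim (FP.<-irrefl refl i<i)
  z-≡ _ _ (inj₁ refl) (inj₂ refl) = refl
  z-≡ i<j j<i (inj₂ refl) (inj₁ refl) = ⊥-elim (FP.<-asym i<j j<i)
  z-≡ i<i _ (inj₂ refl) (inj₂ refl) = ⊥-elim (FP.<-irrefl refl i<i)

  Adj-sym : ∀ {u v} → E u v → E v u
  Adj-sym {a i} {a j} i≢j = i≢j ∘ sym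
  Adj-sym {a i} {b j} i≢j = i≢j ∘ sym
  Adj-sym {b i} {a j} i≢j = i≢j ∘ sym
  Adj-sym {b i} {b j} i≢j = i≢j ∘ sym
  Adj-sym {a _} {z _ _ _} e = e
  Adj-sym {z _ _ _} {a _} e = e
  Adj-sym {b _} {z _ _ _} e = e
  Adj-sym {z _ _ _} {b _} e = e
  Adj-sym {x} {z _ _ _} e = e
  Adj-sym {z _ _ _} {x} e = e

  Adj-irrefl : ∀ {v} → ¬ E v v
  Adj-irrefl {a i} i≢i = i≢i refl
  Adj-irrefl {b i} i≢i = i≢i refl

  ≡-stable : ∀ {i j : Fin s} → ¬ i ≢ j → i ≡ j
  ≡-stable {i} {j} = decidable-stable (i FP.≟ j)

  incidence? : ∀ (t k l : Fin s) → (t ≡ k ⊎ t ≡ l) ⊎ (t ≢ k × t ≢ l)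
  incidence? t k l with t FP.≟ k | t FP.≟ l
  ... | yes t≡k | _ = inj₁ (inj₁ t≡k)
  ... | no _ | yes t≡l = inj₁ (inj₂ t≡l)
  ... | no t≢k | no t≢l = inj₂ (t≢k , t≢l)

  record Sorted (n k : Fin s) : Set where
    constructor sorted
    field
      lo hi : Fin s
      lo<hi : lo <ᶠ hi
      ⊆nk : ∀ t → t ≡ lo ⊎ t ≡ hi → t ≡ n ⊎ t ≡ k
      n∈ : n ≡ lo ⊎ n ≡ hi
      k∈ : k ≡ lo ⊎ k ≡ hi

  sort : ∀ n k → n ≢ k → Sorted n k
  sort n k n≢k with FP.<-cmp n k
  ... | tri< n<k _ _ = sorted n k n<k (λ _ t∈ → t∈) (inj₁ refl) (inj₂ refl)
  ... | tri≈ _ n≡k _ = ⊥-elim (n≢k n≡k)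
  ... | tri> _ _ k<n = sorted k n k<n (λ _ t∈ → ⊎-swap t∈) (inj₂ refl) (inj₁ refl)

  record FreshPair (L : List (Fin s)) : Set where
    constructor fresh-pair
    field
      c d : Fin s
      c<d : c <ᶠ d
      c∉ : c ∉ L
      d∉ : d ∉ L

  opaque
    freshPair : (L : List (Fin s)) → {True (length L ℕ.≤? 4)} → FreshPair L
    freshPair L {|L|≤4} with fresh L {fromWitness (ℕP.m≤n⇒m≤1+n (toWitness |L|≤4))}
    ... | k , k∉L with fresh (k ∷ L) {fromWitness (s≤s (toWitness |L|≤4))}
    ... | l , l∉kL with sort k l (λ k≡l → l∉kL (here (sym k≡l)))
    ... | sorted i j i<j ⊆kl _ _ = fresh-pair i j i<j (∉L i (inj₁ refl)) (∉L j (inj₂ refl))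
      where
      ∉L : ∀ t → t ≡ i ⊎ t ≡ j → t ∉ L
      ∉L t t∈ij with ⊆kl t t∈ij
      ... | inj₁ refl = k∉L
      ... | inj₂ refl = l∉kL ∘ there

  DominatedBy : V → V → Set
  DominatedBy v t = v ≡ t ⊎ E v t

  ¬DominatedBy : ∀ {v t} → v ≢ t → ¬ E v t → ¬ DominatedBy v t
  ¬DominatedBy v≢t _ (inj₁ v≡t) = v≢t v≡t
  ¬DominatedBy _ ¬adj (inj₂ adj) = ¬adj adj

  Dominating₃ : V → V → V → Set
  Dominating₃ p q r = ∀ v → DominatedBy v p ⊎ DominatedBy v q ⊎ DominatedBy v r

  -- In a connected set of two or three vertices each one has a neighbour among the others;
  -- this is all that the lower bound uses of connectivity.
  NoIsolated₃ : V → V → V → Set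
  NoIsolated₃ p q r = (E p q ⊎ E p r) × (E q p ⊎ E q r) × (E r p ⊎ E r q)

  NoIsolated₃-swap₁₂ : ∀ p q r → NoIsolated₃ p q r → NoIsolated₃ q p r
  NoIsolated₃-swap₁₂ _ _ _ (p-linked , q-linked , r-linked) = q-linked , p-linked , ⊎-swap r-linked

  NoIsolated₃-swap₂₃ : ∀ p q r → NoIsolated₃ p q r → NoIsolated₃ p r q
  NoIsolated₃-swap₂₃ _ _ _ (p-linked , q-linked , r-linked) = ⊎-swap p-linked , r-linked , q-linked

  NoIsolated₃-swap₁₃ : ∀ p q r → NoIsolated₃ p q r → NoIsolated₃ r q p
  NoIsolated₃-swap₁₃ _ _ _ (p-linked , q-linked , r-linked) = ⊎-swap r-linked , ⊎-swap q-linked , ⊎-swap p-linked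

  undominated : ∀ {p q r} v → ¬ DominatedBy v p → ¬ DominatedBy v q → ¬ DominatedBy v r → ¬ Dominating₃ p q r
  undominated v ¬p ¬q ¬r dom = [ ¬p , [ ¬q , ¬r ] ] (dom v)

  no-CDS₃-x-z : ∀ {i j} .(i<j : i <ᶠ j) r → Dominating₃ x (z i j i<j) r → E r x ⊎ E r (z i j i<j) → ⊥
  no-CDS₃-x-z {i} {j} _ x dom _ with fresh (i ∷ j ∷ [])
  ... | k , k∉ = undominated (a k) (¬DominatedBy (λ ()) (λ ())) (¬DominatedBy (λ ()) (∉⇒¬incident k∉ ∈₀ ∈₁))
                   (¬DominatedBy (λ ()) (λ ())) dom
  no-CDS₃-x-z {i} {j} _ (z k l _) dom _ with fresh (i ∷ j ∷ k ∷ l ∷ [])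
  ... | m , m∉ = undominated (a m) (¬DominatedBy (λ ()) (λ ())) (¬DominatedBy (λ ()) (∉⇒¬incident m∉ ∈₀ ∈₁))
                   (¬DominatedBy (λ ()) (∉⇒¬incident m∉ ∈₂ ∈₃)) dom
  no-CDS₃-x-z _ (a _) _ (inj₁ ())
  no-CDS₃-x-z _ (a m) dom (inj₂ m∈ij) =
    undominated (b m) (¬DominatedBy (λ ()) (λ ())) (¬DominatedBy (λ ()) λ (m≢i , m≢j) → [ m≢i , m≢j ] m∈ij)
      (¬DominatedBy (λ ()) (λ m≢m → m≢m refl)) dom
  no-CDS₃-x-z _ (b _) _ (inj₁ ())
  no-CDS₃-x-z _ (b m) dom (inj₂ (m≢i , m≢j)) =
    undominated (a m) (¬DominatedBy (λ ()) (λ ())) (¬DominatedBy (λ ()) [ m≢i , m≢j ])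
      (¬DominatedBy (λ ()) (λ m≢m → m≢m refl)) dom

  no-CDS₃-x : ∀ q r → Dominating₃ x q r → NoIsolated₃ x q r → ⊥
  no-CDS₃-x (z _ _ i<j) r dom (inj₁ _ , _ , r-linked) = no-CDS₃-x-z i<j r dom r-linked
  no-CDS₃-x q (z _ _ i<j) dom (inj₂ _ , q-linked , _) = no-CDS₃-x-z i<j q (⊎₃-swap₂₃ ∘ dom) q-linked
  no-CDS₃-x (a _) _ _ (inj₁ () , _)
  no-CDS₃-x (b _) _ _ (inj₁ () , _)
  no-CDS₃-x x _ _ (inj₁ () , _)
  no-CDS₃-x _ (a _) _ (inj₂ () , _)
  no-CDS₃-x _ (b _) _ (inj₂ () , _)
  no-CDS₃-x _ x _ (inj₂ () , _)

  no-CDS₃-z-a-a : ∀ {i j} .(i<j : i <ᶠ j) m n → ¬ Dominating₃ (z i j i<j) (a m) (a n)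
  no-CDS₃-z-a-a {i} {j} _ m n =
    undominated (z c d c<d) (¬DominatedBy (c∉ ∘ here ∘ proj₁ ∘ z-injective) (λ ()))
      (¬DominatedBy (λ ()) (∉⇒¬incident′ c∉ d∉ ∈₂)) (¬DominatedBy (λ ()) (∉⇒¬incident′ c∉ d∉ ∈₃))
    where open FreshPair (freshPair (i ∷ j ∷ m ∷ n ∷ []))

  no-CDS₃-z-a-b : ∀ {i j} .(i<j : i <ᶠ j) m n →
                  Dominating₃ (z i j i<j) (a m) (b n) → NoIsolated₃ (z i j i<j) (a m) (b n) → ⊥
  no-CDS₃-z-a-b {i} {j} i<j m n dom (_ , am-linked , bn-linked) with m FP.≟ n
  ... | yes refl = [ (λ (m≢i , m≢j) → [ m≢i , m≢j ] m∈ij) , (λ m≢m → m≢m refl) ] bn-linked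
    where
    m∈ij : m ≡ i ⊎ m ≡ j
    m∈ij = [ (λ m∈ij → m∈ij) , (λ m≢m → ⊥-elim (m≢m refl)) ] am-linked
  ... | no m≢n with fresh (i ∷ j ∷ m ∷ n ∷ [])
  ... | k , k∉ with sort n k (∉⇒≢ k∉ ∈₃ ∘ sym)
  ... | sorted c d c<d ⊆nk n∈cd k∈cd =
    undominated (z c d c<d) (¬DominatedBy z≢z (λ ())) (¬DominatedBy (λ ()) m∉cd)
      (¬DominatedBy (λ ()) λ (n≢c , n≢d) → [ n≢c , n≢d ] n∈cd) dom
    where
    z≢z : z c d c<d ≢ z i j i<j
    z≢z z≡z with z-injective z≡z
    ... | refl , refl = ∉⇒¬incident k∉ ∈₀ ∈₁ k∈cd
    m∉cd : ¬ (m ≡ c ⊎ m ≡ d)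
    m∉cd m∈cd = [ m≢n , ∉⇒≢ k∉ ∈₂ ∘ sym ] (⊆nk m m∈cd)

  no-CDS₃-z-a-z : ∀ {i j} .(i<j : i <ᶠ j) m {k l} .(k<l : k <ᶠ l) →
                  Dominating₃ (z i j i<j) (a m) (z k l k<l) → NoIsolated₃ (z i j i<j) (a m) (z k l k<l) → ⊥
  no-CDS₃-z-a-z _ _ _ _ (inj₂ () , _)
  no-CDS₃-z-a-z {i} {j} _ m {k} {l} _ dom (inj₁ m∈ij , _) =
    undominated (z c d c<d) (¬DominatedBy (c∉ ∘ here ∘ proj₁ ∘ z-injective) (λ ()))
      (¬DominatedBy (λ ()) m∉cd) (¬DominatedBy (c∉ ∘ there ∘ there ∘ here ∘ proj₁ ∘ z-injective) (λ ())) dom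
    where
    open FreshPair (freshPair (i ∷ j ∷ k ∷ l ∷ []))
    m∉cd : ¬ (m ≡ c ⊎ m ≡ d)
    m∉cd (inj₁ refl) = ∉⇒¬incident c∉ ∈₀ ∈₁ m∈ij
    m∉cd (inj₂ refl) = ∉⇒¬incident d∉ ∈₀ ∈₁ m∈ij

  no-CDS₃-z-b-b : ∀ {i j} .(i<j : i <ᶠ j) m n →
                  Dominating₃ (z i j i<j) (b m) (b n) → NoIsolated₃ (z i j i<j) (b m) (b n) → ⊥
  no-CDS₃-z-b-b {i} {j} i<j m n dom (z-linked , _) with m FP.≟ n
  ... | yes refl = undominated (a m) (¬DominatedBy (λ ()) m∉ij) (¬DominatedBy (λ ()) (λ m≢m → m≢m refl))
                     (¬DominatedBy (λ ()) (λ m≢m → m≢m refl)) dom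
    where
    m∉ij : ¬ (m ≡ i ⊎ m ≡ j)
    m∉ij m∈ij = [ (λ (m≢i , m≢j) → [ m≢i , m≢j ] m∈ij) , (λ (m≢i , m≢j) → [ m≢i , m≢j ] m∈ij) ] z-linked
  ... | no m≢n with sort m n m≢n
  ... | sorted c d c<d _ m∈cd n∈cd =
    undominated (z c d c<d) (¬DominatedBy z≢z (λ ())) (¬DominatedBy (λ ()) λ (m≢c , m≢d) → [ m≢c , m≢d ] m∈cd)
      (¬DominatedBy (λ ()) λ (n≢c , n≢d) → [ n≢c , n≢d ] n∈cd) dom
    where
    z≢z : z c d c<d ≢ z i j i<j
    z≢z z≡z with z-injective z≡z
    ... | refl , refl = [ (λ (m≢c , m≢d) → [ m≢c , m≢d ] m∈cd) , (λ (n≢c , n≢d) → [ n≢c , n≢d ] n∈cd) ] z-linked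

  no-CDS₃-z-b-z : ∀ {i j} .(i<j : i <ᶠ j) m {k l} .(k<l : k <ᶠ l) →
                  Dominating₃ (z i j i<j) (b m) (z k l k<l) → NoIsolated₃ (z i j i<j) (b m) (z k l k<l) → ⊥
  no-CDS₃-z-b-z _ _ _ _ (inj₂ () , _)
  no-CDS₃-z-b-z _ _ _ _ (inj₁ _ , _ , inj₁ ())
  no-CDS₃-z-b-z _ m _ dom (inj₁ (m≢i , m≢j) , _ , inj₂ (m≢k , m≢l)) =
    undominated (a m) (¬DominatedBy (λ ()) [ m≢i , m≢j ]) (¬DominatedBy (λ ()) (λ m≢m → m≢m refl))
      (¬DominatedBy (λ ()) [ m≢k , m≢l ]) dom

  no-CDS₃-z : ∀ {i j} .(i<j : i <ᶠ j) q r → Dominating₃ (z i j i<j) q r → NoIsolated₃ (z i j i<j) q r → ⊥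
  no-CDS₃-z i<j x r dom linked = no-CDS₃-x (z _ _ i<j) r (⊎₃-swap₁₂ ∘ dom) (NoIsolated₃-swap₁₂ (z _ _ i<j) x r linked)
  no-CDS₃-z i<j q x dom linked = no-CDS₃-x q (z _ _ i<j) (⊎₃-swap₁₃ ∘ dom) (NoIsolated₃-swap₁₃ (z _ _ i<j) q x linked)
  no-CDS₃-z _ (z _ _ _) (z _ _ _) _ (inj₁ () , _)
  no-CDS₃-z _ (z _ _ _) (z _ _ _) _ (inj₂ () , _)
  no-CDS₃-z i<j (a m) (a n) dom _ = no-CDS₃-z-a-a i<j m n dom
  no-CDS₃-z i<j (a m) (b n) dom linked = no-CDS₃-z-a-b i<j m n dom linked
  no-CDS₃-z i<j (b n) (a m) dom linked =
    no-CDS₃-z-a-b i<j m n (⊎₃-swap₂₃ ∘ dom) (NoIsolated₃-swap₂₃ (z _ _ i<j) (b n) (a m) linked)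
  no-CDS₃-z i<j (a m) (z _ _ k<l) dom linked = no-CDS₃-z-a-z i<j m k<l dom linked
  no-CDS₃-z i<j (z _ _ k<l) (a m) dom linked =
    no-CDS₃-z-a-z i<j m k<l (⊎₃-swap₂₃ ∘ dom) (NoIsolated₃-swap₂₃ (z _ _ i<j) (z _ _ k<l) (a m) linked)
  no-CDS₃-z i<j (b m) (b n) dom linked = no-CDS₃-z-b-b i<j m n dom linked
  no-CDS₃-z i<j (b m) (z _ _ k<l) dom linked = no-CDS₃-z-b-z i<j m k<l dom linked
  no-CDS₃-z i<j (z _ _ k<l) (b m) dom linked =
    no-CDS₃-z-b-z i<j m k<l (⊎₃-swap₂₃ ∘ dom) (NoIsolated₃-swap₂₃ (z _ _ i<j) (z _ _ k<l) (b m) linked)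

  no-CDS₃-first-dominates-x : ∀ p q r → DominatedBy x p → Dominating₃ p q r → NoIsolated₃ p q r → ⊥
  no-CDS₃-first-dominates-x x q r _ = no-CDS₃-x q r
  no-CDS₃-first-dominates-x (z _ _ i<j) q r _ = no-CDS₃-z i<j q r
  no-CDS₃-first-dominates-x (a _) _ _ (inj₁ ())
  no-CDS₃-first-dominates-x (a _) _ _ (inj₂ ())
  no-CDS₃-first-dominates-x (b _) _ _ (inj₁ ())
  no-CDS₃-first-dominates-x (b _) _ _ (inj₂ ())

  no-CDS₃ : ∀ p q r → Dominating₃ p q r → NoIsolated₃ p q r → ⊥
  no-CDS₃ p q r dom linked with dom x
  ... | inj₁ x-by-p = no-CDS₃-first-dominates-x p q r x-by-p dom linked
  ... | inj₂ (inj₁ x-by-q) =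
    no-CDS₃-first-dominates-x q p r x-by-q (⊎₃-swap₁₂ ∘ dom) (NoIsolated₃-swap₁₂ p q r linked)
  ... | inj₂ (inj₂ x-by-r) =
    no-CDS₃-first-dominates-x r q p x-by-r (⊎₃-swap₁₃ ∘ dom) (NoIsolated₃-swap₁₃ p q r linked)

  module _ {S : List V} {p q r : V} (⊆pqr : ∀ {w} → w ∈ S → w ≡ p ⊎ w ≡ q ⊎ w ≡ r) (cds : IsCDS E S) where

    IsCDS⇒Dominating₃ : Dominating₃ p q r
    IsCDS⇒Dominating₃ v with proj₁ (proj₂ cds) v
    ... | inj₁ v∈S = Sum.map inj₁ (Sum.map inj₁ inj₁) (⊆pqr v∈S)
    ... | inj₂ (t , t∈S , v∼t) = Sum.map by-t (Sum.map by-t by-t) (⊆pqr t∈S)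
      where
      by-t : ∀ {u} → t ≡ u → DominatedBy v u
      by-t refl = inj₂ v∼t

    IsCDS⇒neighbour : ∀ {u v} → u ∈ S → v ∈ S → u ≢ v → ∃ λ w → (w ≡ p ⊎ w ≡ q ⊎ w ≡ r) × E u w
    IsCDS⇒neighbour u∈S v∈S u≢v with first-step (proj₂ (proj₂ cds) _ _ u∈S v∈S) u≢v
    ... | w , w∈S , u∼w = w , ⊆pqr w∈S , u∼w

    IsCDS⇒NoIsolated₃ : p ∈ S → q ∈ S → r ∈ S → p ≢ q → r ≢ p → NoIsolated₃ p q r
    IsCDS⇒NoIsolated₃ p∈S q∈S r∈S p≢q r≢p =
      other-neighbour (IsCDS⇒neighbour p∈S q∈S p≢q) ,
      other-neighbour (Product.map₂ (Product.map₁ ⊎₃-swap₁₂) (IsCDS⇒neighbour q∈S p∈S (p≢q ∘ sym))) ,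
      ⊎-swap (other-neighbour (Product.map₂ (Product.map₁ ⊎₃-swap₁₃) (IsCDS⇒neighbour r∈S p∈S r≢p)))
      where
      other-neighbour : ∀ {u v t} → (∃ λ w → (w ≡ u ⊎ w ≡ v ⊎ w ≡ t) × E u w) → E u v ⊎ E u t
      other-neighbour (_ , inj₁ refl , u∼u) = ⊥-elim (Adj-irrefl u∼u)
      other-neighbour (_ , inj₂ (inj₁ refl) , u∼v) = inj₁ u∼v
      other-neighbour (_ , inj₂ (inj₂ refl) , u∼t) = inj₂ u∼t

  no-dominating-vertex : ∀ p → ¬ Dominating₃ p p p
  no-dominating-vertex p dom = not-dominated p (λ v → [ id , [ id , id ] ] (dom v))
    where
    not-dominated : ∀ p → ¬ (∀ v → DominatedBy v p)
    not-dominated (a i) by-ai = ¬DominatedBy (λ ()) (λ i≢i → i≢i refl) (by-ai (b i))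
    not-dominated (b i) by-bi = ¬DominatedBy (λ ()) (λ i≢i → i≢i refl) (by-bi (a i))
    not-dominated x by-x = ¬DominatedBy (λ ()) (λ ()) (by-x (a index₀))
    not-dominated (z i _ _) by-z = ¬DominatedBy (λ ()) (λ (i≢i , _) → i≢i refl) (by-z (b i))

  CDS-length-≥4 : ∀ S → IsCDS E S → 4 ≤ length S
  CDS-length-≥4 [] cds = ⊥-elim (no-dominating-vertex x (IsCDS⇒Dominating₃ (λ ()) cds))
  CDS-length-≥4 (p ∷ []) cds = ⊥-elim (no-dominating-vertex p (IsCDS⇒Dominating₃ ⊆ppp cds))
    where
    ⊆ppp : ∀ {w} → w ∈ p ∷ [] → w ≡ p ⊎ w ≡ p ⊎ w ≡ p
    ⊆ppp (here refl) = inj₁ refl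
  CDS-length-≥4 (p ∷ q ∷ []) cds@((p≢q ∷ []) ∷ _ , _) =
    ⊥-elim (no-CDS₃ p q q (IsCDS⇒Dominating₃ ⊆pqq cds) (IsCDS⇒NoIsolated₃ ⊆pqq cds ∈₀ ∈₁ ∈₁ p≢q (p≢q ∘ sym)))
    where
    ⊆pqq : ∀ {w} → w ∈ p ∷ q ∷ [] → w ≡ p ⊎ w ≡ q ⊎ w ≡ q
    ⊆pqq (here refl) = inj₁ refl
    ⊆pqq (there (here refl)) = inj₂ (inj₁ refl)
  CDS-length-≥4 (p ∷ q ∷ r ∷ []) cds@((p≢q ∷ p≢r ∷ []) ∷ _ , _) =
    ⊥-elim (no-CDS₃ p q r (IsCDS⇒Dominating₃ ⊆pqr cds) (IsCDS⇒NoIsolated₃ ⊆pqr cds ∈₀ ∈₁ ∈₂ p≢q (p≢r ∘ sym)))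
    where
    ⊆pqr : ∀ {w} → w ∈ p ∷ q ∷ r ∷ [] → w ≡ p ⊎ w ≡ q ⊎ w ≡ r
    ⊆pqr (here refl) = inj₁ refl
    ⊆pqr (there (here refl)) = inj₂ (inj₁ refl)
    ⊆pqr (there (there (here refl))) = inj₂ (inj₂ refl)
  CDS-length-≥4 (_ ∷ _ ∷ _ ∷ _ ∷ _) _ = s≤s (s≤s (s≤s (s≤s z≤n)))

  standard-CDS : ∀ i k {c d} .(c<d : c <ᶠ d) → i ≡ c ⊎ i ≡ d → i ≢ k → IsCDS E (x ∷ z c d c<d ∷ a i ∷ b k ∷ [])
  standard-CDS i k c<d i∈cd i≢k = Consec⇒IsCDS Adj-sym distinct (c2 tt (c2 i∈cd (c2 i≢k c1))) dominating
    where
    distinct : Unique (x ∷ z _ _ c<d ∷ a i ∷ b k ∷ [])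
    distinct = ((λ ()) ∷ (λ ()) ∷ (λ ()) ∷ []) ∷ ((λ ()) ∷ (λ ()) ∷ []) ∷ ((λ ()) ∷ []) ∷ [] ∷ []
    dominating : Dominates E (x ∷ z _ _ c<d ∷ a i ∷ b k ∷ [])
    dominating (a m) with m FP.≟ i
    ... | yes refl = inj₁ ∈₂
    ... | no m≢i = inj₂ (a i , ∈₂ , m≢i)
    dominating (b m) with m FP.≟ i
    ... | yes refl = inj₂ (b k , ∈₃ , i≢k)
    ... | no m≢i = inj₂ (a i , ∈₂ , m≢i)
    dominating (z _ _ _) = inj₂ (x , ∈₀ , tt)
    dominating x = inj₁ ∈₀

  γc-set-through : V → Set
  γc-set-through v = Σ (List V) λ S → IsGammaCSet E 4 S × v ∈ S × Σ V (λ h → h ∈ S × IsB2 s h)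

  standard-γc-set : ∀ {v} i k {c d} .(c<d : c <ᶠ d) → i ≡ c ⊎ i ≡ d → i ≢ k →
                    v ∈ x ∷ z c d c<d ∷ a i ∷ b k ∷ [] → γc-set-through v
  standard-γc-set i k c<d i∈cd i≢k v∈S = _ , (standard-CDS i k c<d i∈cd i≢k , refl) , v∈S , b k , ∈₃ , tt

  γc-set-with-a : ∀ i {v} → (∀ {k c d} .{c<d : c <ᶠ d} → v ∈ x ∷ z c d c<d ∷ a i ∷ b k ∷ []) → γc-set-through v
  γc-set-with-a i v∈S with fresh (i ∷ [])
  ... | k , k∉ with sort i k (∉⇒≢ k∉ ∈₀ ∘ sym)
  ... | sorted c d c<d _ i∈cd _ = standard-γc-set i k c<d i∈cd (∉⇒≢ k∉ ∈₀ ∘ sym) v∈S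

  γc-set-through-every : ∀ v → γc-set-through v
  γc-set-through-every (a i) = γc-set-with-a i ∈₂
  γc-set-through-every x = γc-set-with-a index₀ ∈₀
  γc-set-through-every (b k) with fresh (k ∷ [])
  ... | i , i∉ with fresh (i ∷ [])
  ... | j , j∉ with sort i j (λ i≡j → ∉⇒≢ j∉ ∈₀ (sym i≡j))
  ... | sorted c d c<d _ i∈cd _ = standard-γc-set i k c<d i∈cd (∉⇒≢ i∉ ∈₀) ∈₃
  γc-set-through-every (z c d c<d) with fresh (c ∷ [])
  ... | k , k∉ = standard-γc-set c k c<d (inj₁ refl) (∉⇒≢ k∉ ∈₀ ∘ sym) ∈₁

  γc≡4 : GammaC E 4
  γc≡4 = (proj₁ (γc-set-through-every x) , proj₁ (proj₂ (γc-set-through-every x))) , CDS-length-≥4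

  module Augmented (u v : V) where

    E⁺ : V → V → Set
    E⁺ = AddEdge E u v

    E⁺-sym : ∀ {p q} → E⁺ p q → E⁺ q p
    E⁺-sym = AddEdge-sym Adj-sym

    SmallCDS : Set
    SmallCDS = Σ (List V) λ D → IsCDS E⁺ D × Σ V (λ h → h ∈ D × IsB2 s h) × length D < 4

    small : ∀ {p q r} → Unique (p ∷ q ∷ r ∷ []) → E⁺ p q → E⁺ q r → Dominates E⁺ (p ∷ q ∷ r ∷ []) →
            ∀ {h} → h ∈ p ∷ q ∷ r ∷ [] → IsB2 s h → SmallCDS
    small distinct pq qr dominating h∈ h∈B₂ =
      _ , Consec⇒IsCDS E⁺-sym distinct (c2 pq (c2 qr c1)) dominating , (_ , h∈ , h∈B₂) , s≤s (s≤s (s≤s (s≤s z≤n)))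

    small-b-z-x : ∀ i {c d} .(c<d : c <ᶠ d) → i ≢ c → i ≢ d →
                  (∃ λ t → t ∈ b i ∷ z c d c<d ∷ x ∷ [] × E⁺ (a i) t) → SmallCDS
    small-b-z-x i c<d i≢c i≢d a-i-dominated =
      small (((λ ()) ∷ (λ ()) ∷ []) ∷ ((λ ()) ∷ []) ∷ [] ∷ []) (inj₁ (i≢c , i≢d)) (inj₁ tt) dominating ∈₀ tt
      where
      dominating : Dominates E⁺ (b i ∷ z _ _ c<d ∷ x ∷ [])
      dominating (a m) with m FP.≟ i
      ... | yes refl = inj₂ a-i-dominated
      ... | no m≢i = inj₂ (b i , ∈₀ , inj₁ m≢i)
      dominating (b m) with m FP.≟ i
      ... | yes refl = inj₁ ∈₀
      ... | no m≢i = inj₂ (b i , ∈₀ , inj₁ m≢i)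
      dominating (z _ _ _) = inj₂ (x , ∈₂ , inj₁ tt)
      dominating x = inj₁ ∈₂

    small-b-z-x-fresh : ∀ i → (∀ {c d} .(c<d : c <ᶠ d) → ∃ λ t → t ∈ b i ∷ z c d c<d ∷ x ∷ [] × E⁺ (a i) t) → SmallCDS
    small-b-z-x-fresh i a-i-dominated = small-b-z-x i c<d (∉⇒≢ c∉ ∈₀ ∘ sym) (∉⇒≢ d∉ ∈₀ ∘ sym) (a-i-dominated c<d)
      where open FreshPair (freshPair (i ∷ []))

    small-b-b-z : ∀ i j → i ≢ j → ∀ {c d} .(c<d : c <ᶠ d) → E⁺ (b i) (z c d c<d) →
                  (∀ k l .(k<l : k <ᶠ l) → i ≡ k ⊎ i ≡ l → j ≡ k ⊎ j ≡ l →
                     z k l k<l ∈ b j ∷ b i ∷ z c d c<d ∷ [] ⊎ ∃ λ t → t ∈ b j ∷ b i ∷ z c d c<d ∷ [] × E⁺ (z k l k<l) t) →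
                  SmallCDS
    small-b-b-z i j i≢j c<d bi-z z-ij-dominated =
      small (((i≢j ∘ sym ∘ b-injective) ∷ (λ ()) ∷ []) ∷ ((λ ()) ∷ []) ∷ [] ∷ []) (inj₁ (i≢j ∘ sym)) bi-z dominating ∈₁ tt
      where
      dominating : Dominates E⁺ (b j ∷ b i ∷ z _ _ c<d ∷ [])
      dominating (a m) with m FP.≟ i
      ... | yes refl = inj₂ (b j , ∈₀ , inj₁ i≢j)
      ... | no m≢i = inj₂ (b i , ∈₁ , inj₁ m≢i)
      dominating (b m) with m FP.≟ i
      ... | yes refl = inj₁ ∈₁
      ... | no m≢i = inj₂ (b i , ∈₁ , inj₁ m≢i)
      dominating (z k l k<l) with incidence? i k l | incidence? j k l
      ... | inj₂ i∉kl | _ = inj₂ (b i , ∈₁ , inj₁ i∉kl)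
      ... | inj₁ _ | inj₂ j∉kl = inj₂ (b j , ∈₀ , inj₁ j∉kl)
      ... | inj₁ i∈kl | inj₁ j∈kl = z-ij-dominated k l k<l i∈kl j∈kl
      dominating x = inj₂ (z _ _ c<d , ∈₂ , inj₁ tt)

    small-a-b-b : ∀ i j → i ≢ j → E⁺ x (b i) → SmallCDS
    small-a-b-b i j i≢j x-bi =
      small (((λ ()) ∷ (λ ()) ∷ []) ∷ ((i≢j ∘ sym ∘ b-injective) ∷ []) ∷ [] ∷ []) (inj₁ i≢j) (inj₁ (i≢j ∘ sym)) dominating ∈₂ tt
      where
      dominating : Dominates E⁺ (a i ∷ b j ∷ b i ∷ [])
      dominating (a m) with m FP.≟ i
      ... | yes refl = inj₁ ∈₀
      ... | no m≢i = inj₂ (a i , ∈₀ , inj₁ m≢i)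
      dominating (b m) with m FP.≟ i
      ... | yes refl = inj₁ ∈₂
      ... | no m≢i = inj₂ (b i , ∈₂ , inj₁ m≢i)
      dominating (z k l _) with incidence? i k l
      ... | inj₁ i∈kl = inj₂ (a i , ∈₀ , inj₁ i∈kl)
      ... | inj₂ i∉kl = inj₂ (b i , ∈₂ , inj₁ i∉kl)
      dominating x = inj₂ (b i , ∈₂ , x-bi)

    small-b-z : ∀ i {c d} .(c<d : c <ᶠ d) → i ≡ c ⊎ i ≡ d → E⁺ (b i) (z c d c<d) → SmallCDS
    small-b-z i {_} {d} c<d (inj₁ refl) bi-z = small-b-b-z i d (<⇒≢ c<d) c<d bi-z λ k l k<l i∈kl d∈kl →
      inj₁ (subst (_∈ b d ∷ b i ∷ z i d c<d ∷ []) (z-≡ (recompute-< c<d) (recompute-< k<l) i∈kl d∈kl) ∈₂)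
    small-b-z i {c} c<d (inj₂ refl) bi-z = small-b-b-z i c (<⇒≢ c<d ∘ sym) c<d bi-z λ k l k<l i∈kl c∈kl →
      inj₁ (subst (_∈ b c ∷ b i ∷ z c i c<d ∷ []) (z-≡ (recompute-< c<d) (recompute-< k<l) c∈kl i∈kl) ∈₂)

    small-z-z : ∀ {c d e f} .(c<d : c <ᶠ d) .(e<f : e <ᶠ f) → z c d c<d ≢ z e f e<f →
                E⁺ (z e f e<f) (z c d c<d) → SmallCDS
    small-z-z {c} {d} {e} {f} c<d e<f z≢z zz with incidence? e c d | incidence? f c d
    ... | inj₂ e∉cd | _ = small-b-b-z e f (<⇒≢ e<f) c<d (inj₁ e∉cd) λ k l k<l e∈kl f∈kl →
      inj₂ (z c d c<d , ∈₂ , subst (λ w → E⁺ w (z c d c<d)) (z-≡ (recompute-< e<f) (recompute-< k<l) e∈kl f∈kl) zz)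
    ... | inj₁ _ | inj₂ f∉cd = small-b-b-z f e (<⇒≢ e<f ∘ sym) c<d (inj₁ f∉cd) λ k l k<l f∈kl e∈kl →
      inj₂ (z c d c<d , ∈₂ , subst (λ w → E⁺ w (z c d c<d)) (z-≡ (recompute-< e<f) (recompute-< k<l) e∈kl f∈kl) zz)
    ... | inj₁ e∈cd | inj₁ f∈cd = ⊥-elim (z≢z (sym (z-≡ (recompute-< e<f) (recompute-< c<d) e∈cd f∈cd)))

  open Augmented using (SmallCDS)

  critical-pair : ∀ u v → NonAdjPair E u v → SmallCDS u v
  critical-pair (a i) (a j) (a≢a , ¬adj) = ⊥-elim (a≢a (cong a (≡-stable ¬adj)))
  critical-pair (b i) (b j) (b≢b , ¬adj) = ⊥-elim (b≢b (cong b (≡-stable ¬adj)))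
  critical-pair (a i) (b j) (_ , ¬adj) with ≡-stable ¬adj
  ... | refl = Augmented.small-b-z-x-fresh (a i) (b i) i λ _ → b i , ∈₀ , inj₂ (inj₁ (refl , refl))
  critical-pair (b j) (a i) (_ , ¬adj) with ≡-stable ¬adj
  ... | refl = Augmented.small-b-z-x-fresh (b i) (a i) i λ _ → b i , ∈₀ , inj₂ (inj₂ (refl , refl))
  critical-pair (a i) (z c d c<d) (_ , ¬adj) =
    Augmented.small-b-z-x (a i) (z c d c<d) i c<d (¬adj ∘ inj₁) (¬adj ∘ inj₂) (z c d c<d , ∈₁ , inj₂ (inj₁ (refl , refl)))
  critical-pair (z c d c<d) (a i) (_ , ¬adj) =
    Augmented.small-b-z-x (z c d c<d) (a i) i c<d (¬adj ∘ inj₁) (¬adj ∘ inj₂) (z c d c<d , ∈₁ , inj₂ (inj₂ (refl , refl)))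
  critical-pair (a i) x _ = Augmented.small-b-z-x-fresh (a i) x i λ _ → x , ∈₂ , inj₂ (inj₁ (refl , refl))
  critical-pair x (a i) _ = Augmented.small-b-z-x-fresh x (a i) i λ _ → x , ∈₂ , inj₂ (inj₂ (refl , refl))
  critical-pair (b i) (z c d c<d) (_ , ¬adj) with incidence? i c d
  ... | inj₂ i∉cd = ⊥-elim (¬adj i∉cd)
  ... | inj₁ i∈cd = Augmented.small-b-z (b i) (z c d c<d) i c<d i∈cd (inj₂ (inj₁ (refl , refl)))
  critical-pair (z c d c<d) (b i) (_ , ¬adj) with incidence? i c d
  ... | inj₂ i∉cd = ⊥-elim (¬adj i∉cd)
  ... | inj₁ i∈cd = Augmented.small-b-z (z c d c<d) (b i) i c<d i∈cd (inj₂ (inj₂ (refl , refl)))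
  critical-pair (b i) x _ with fresh (i ∷ [])
  ... | j , j∉ = Augmented.small-a-b-b (b i) x i j (∉⇒≢ j∉ ∈₀ ∘ sym) (inj₂ (inj₂ (refl , refl)))
  critical-pair x (b i) _ with fresh (i ∷ [])
  ... | j , j∉ = Augmented.small-a-b-b x (b i) i j (∉⇒≢ j∉ ∈₀ ∘ sym) (inj₂ (inj₁ (refl , refl)))
  critical-pair (z c d c<d) (z e f e<f) (z≢z , _) =
    Augmented.small-z-z (z c d c<d) (z e f e<f) c<d e<f z≢z (inj₂ (inj₂ (refl , refl)))
  critical-pair (z _ _ _) x (_ , ¬adj) = ⊥-elim (¬adj tt)
  critical-pair x (z _ _ _) (_ , ¬adj) = ⊥-elim (¬adj tt)
  critical-pair x x (x≢x , _) = ⊥-elim (x≢x refl)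

  B₂-maximal-clique : IsMaxClique E (IsB2 s)
  B₂-maximal-clique = clique , maximal
    where
    clique : IsClique E (IsB2 s)
    clique (b i) (b j) _ _ b≢b = b≢b ∘ cong b
    maximal : ∀ Q → IsClique E Q → (∀ v → IsB2 s v → Q v) → ∀ v → Q v → IsB2 s v
    maximal Q Q-clique B₂⊆Q (a i) Qai = ⊥-elim (Q-clique (a i) (b i) Qai (B₂⊆Q (b i) tt) (λ ()) refl)
    maximal Q Q-clique B₂⊆Q (b i) _ = tt
    maximal Q Q-clique B₂⊆Q (z c d c<d) Qz = ⊥-elim (proj₁ (Q-clique (z c d c<d) (b c) Qz (B₂⊆Q (b c) tt) (λ ())) refl)
    maximal Q Q-clique B₂⊆Q x Qx = Q-clique x (b index₀) Qx (B₂⊆Q (b index₀) tt) (λ ())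

  two-in-B₂ : Σ V λ h₁ → Σ V λ h₂ → IsB2 s h₁ × IsB2 s h₂ × h₁ ≢ h₂
  two-in-B₂ with fresh (index₀ ∷ [])
  ... | j , j∉ = b index₀ , b j , tt , tt , ∉⇒≢ j∉ ∈₀ ∘ sym ∘ b-injective

  index₁ index₂ : V → Fin s
  index₁ (a i) = i
  index₁ (b i) = i
  index₁ (z i _ _) = i
  index₁ x = index₀   -- x has no index; any fixed one will do
  index₂ (z _ j _) = j
  index₂ v = index₁ v

  indices : V → List (Fin s)
  indices v = index₁ v ∷ index₂ v ∷ []

  b-∉-indices : ∀ {m} v → m ∉ indices v → b m ≢ v
  b-∉-indices (b _) m∉ refl = m∉ ∈₀

  z-∉-indices : ∀ {k l} .{k<l : k <ᶠ l} v → k ∉ indices v → z k l k<l ≢ v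
  z-∉-indices (z _ _ _) k∉ refl = k∉ ∈₀

  module Avoiding (w : V) where

    Avoids : V → Set
    Avoids v = v ≢ w

    hub : Fin s
    hub = proj₁ (fresh (indices w))

    hub-avoids : Avoids (b hub)
    hub-avoids = b-∉-indices w (proj₂ (fresh (indices w)))

    b-to-hub : ∀ m → Avoids (b m) → Walk E Avoids (b m) (b hub)
    b-to-hub m bm-avoids with m FP.≟ hub
    ... | yes refl = here bm-avoids
    ... | no m≢hub = step bm-avoids m≢hub (here hub-avoids)

    z-to-hub : ∀ k l .(k<l : k <ᶠ l) → Avoids (z k l k<l) → Walk E Avoids (z k l k<l) (b hub)
    z-to-hub k l k<l z-avoids with fresh (indices w ++ k ∷ l ∷ [])
    ... | m , m∉ = step z-avoids (∉⇒≢ m∉ ∈₂ , ∉⇒≢ m∉ ∈₃) (b-to-hub m (b-∉-indices w (m∉ ∘ ∈-++⁺ˡ)))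

    to-hub : ∀ v → Avoids v → Walk E Avoids v (b hub)
    to-hub (a m) am-avoids with fresh (indices w ++ m ∷ [])
    ... | j , j∉ = step am-avoids (∉⇒≢ j∉ ∈₂ ∘ sym) (b-to-hub j (b-∉-indices w (j∉ ∘ ∈-++⁺ˡ)))
    to-hub (b m) bm-avoids = b-to-hub m bm-avoids
    to-hub (z k l k<l) z-avoids = z-to-hub k l k<l z-avoids
    to-hub x x-avoids = step x-avoids tt (z-to-hub c d c<d (z-∉-indices w c∉))
      where open FreshPair (freshPair (indices w))

    walk-avoiding : ∀ u v → Avoids u → Avoids v → Walk E Avoids u v
    walk-avoiding u v u-avoids v-avoids = to-hub u u-avoids ++ʷ reverse Adj-sym (to-hub v v-avoids)

  no-cut-vertex : ¬ HasCutVertex E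
  no-cut-vertex (w , w-cuts) = w-cuts (Avoiding.walk-avoiding w)

  connected : Connected E
  connected u v with fresh (indices u ++ indices v)
  ... | m , m∉ = map-Walk (λ _ → tt)
    (Avoiding.walk-avoiding (b m) u v (b-∉-indices u (m∉ ∘ ∈-++⁺ˡ) ∘ sym) (b-∉-indices v (m∉ ∘ ∈-++⁺ʳ (indices u)) ∘ sym))

  IsZ : V → Set
  IsZ (z _ _ _) = ⊤
  IsZ _ = ⊥

  IsZ? : Decidable IsZ
  IsZ? (a _) = no λ ()
  IsZ? (b _) = no λ ()
  IsZ? (z _ _ _) = yes tt
  IsZ? x = no λ ()

  B₃-independent : ∀ {u v} → IsZ u → E u v → ¬ IsZ v
  B₃-independent {z _ _ _} {z _ _ _} _ ()

  non-B₃ : List V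
  non-B₃ = x ∷ map a (allFin s) ++ map b (allFin s)

  length-non-B₃ : length non-B₃ ≡ suc (s + s)
  length-non-B₃ = cong suc (begin
    length (map a (allFin s) ++ map b (allFin s))       ≡⟨ LP.length-++ (map a (allFin s)) ⟩
    length (map a (allFin s)) + length (map b (allFin s)) ≡⟨ cong₂ _+_ (LP.length-map a (allFin s)) (LP.length-map b (allFin s)) ⟩
    length (allFin s) + length (allFin s)               ≡⟨ cong₂ _+_ |allFin| |allFin| ⟩
    s + s                                               ∎)
    where
    open ≡-Reasoning
    |allFin| : length (allFin s) ≡ s
    |allFin| = LP.length-tabulate (λ i → i)

  ∈-non-B₃ : ∀ v → ¬ IsZ v → v ∈ non-B₃
  ∈-non-B₃ (a i) _ = there (∈-++⁺ˡ (∈-map⁺ a (∈-allFin i)))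
  ∈-non-B₃ (b i) _ = there (∈-++⁺ʳ (map a (allFin s)) (∈-map⁺ b (∈-allFin i)))
  ∈-non-B₃ (z _ _ _) ¬IsZ = ⊥-elim (¬IsZ tt)
  ∈-non-B₃ x _ = ∈₀

  z-of-pair : Fin s × Fin s → V
  z-of-pair (i , j) with i F.<? j
  ... | yes i<j = z i j i<j
  ... | no _ = x   -- junk value, never used on the ordered pairs below

  z-of-pair-IsZ : ∀ {i j} → i <ᶠ j → IsZ (z-of-pair (i , j))
  z-of-pair-IsZ {i} {j} i<j with i F.<? j
  ... | yes _ = tt
  ... | no i≮j = ⊥-elim (i≮j i<j)

  z-of-pair-injective : ∀ {i j k l} → i <ᶠ j → k <ᶠ l → z-of-pair (i , j) ≡ z-of-pair (k , l) → (i , j) ≡ (k , l)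
  z-of-pair-injective {i} {j} {k} {l} i<j k<l eq with i F.<? j | k F.<? l
  ... | no i≮j | _ = ⊥-elim (i≮j i<j)
  ... | yes _ | no k≮l = ⊥-elim (k≮l k<l)
  ... | yes _ | yes _ with z-injective eq
  ...   | refl , refl = refl

  B₃ : List V
  B₃ = map z-of-pair (ordered-pairs s)

  B₃-Unique : Unique B₃
  B₃-Unique = go (ordered-pairs-Unique s) ordered-pairs-<
    where
    go : ∀ {ps} → Unique ps → (∀ {i j} → (i , j) ∈ ps → i <ᶠ j) → Unique (map z-of-pair ps)
    go [] _ = []
    go {p ∷ ps} (p∉ps ∷ unique) ordered = All.tabulate p≢ ∷ go unique (ordered ∘ there)
      where
      p≢ : ∀ {v} → v ∈ map z-of-pair ps → z-of-pair p ≢ v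
      p≢ v∈ eq with ∈-map⁻ z-of-pair v∈
      ... | q , q∈ps , refl = All.lookup p∉ps q∈ps (z-of-pair-injective (ordered ∈₀) (ordered (there q∈ps)) eq)

  2s+3≤|B₃| : 3 + (s + s) ≤ length B₃
  2s+3≤|B₃| = subst (3 + (s + s) ≤_) (sym (LP.length-map z-of-pair (ordered-pairs s))) (2n+3≤length-ordered-pairs 6≤s)

  not-traceable : ¬ Traceable E
  not-traceable (L , L-unique , spanning , path) = ℕP.<-irrefl refl (ℕP.≤-trans lower upper)
    where
    B₃⊆L : ∀ {v} → v ∈ B₃ → v ∈ filter IsZ? L
    B₃⊆L v∈ with ∈-map⁻ z-of-pair v∈
    ... | _ , p∈ , refl = ∈-filter⁺ IsZ? (spanning _) (z-of-pair-IsZ (ordered-pairs-< p∈))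
    rest⊆non-B₃ : ∀ {v} → v ∈ filter (¬? ∘ IsZ?) L → v ∈ non-B₃
    rest⊆non-B₃ v∈ = ∈-non-B₃ _ (proj₂ (∈-filter⁻ (¬? ∘ IsZ?) {xs = L} v∈))
    lower : 3 + (s + s) ≤ length (filter IsZ? L)
    lower = ℕP.≤-trans 2s+3≤|B₃| (Unique-length-≤ B₃-Unique B₃⊆L)
    upper : length (filter IsZ? L) ≤ 2 + (s + s)
    upper = ℕP.≤-trans (Consec⇒independent≤1+rest IsZ? B₃-independent path)
      (s≤s (subst (length (filter (¬? ∘ IsZ?) L) ≤_) length-non-B₃ (Unique-length-≤ (Unique.filter⁺ (¬? ∘ IsZ?) L-unique) rest⊆non-B₃)))

  critical : Critical E 4
  critical = connected , γc≡4 , λ u v uv-missing → forget-B₂ (critical-pair u v uv-missing)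
    where
    forget-B₂ : ∀ {u v} → SmallCDS u v → Σ (List V) λ D → IsCDS (AddEdge E u v) D × length D < 4
    forget-B₂ (D , D-CDS , _ , |D|<4) = D , D-CDS , |D|<4

lemma5p1 : (s : ℕ) → 6 ≤ s →
    (Critical (Adj s) 4 × ¬ HasCutVertex (Adj s) × ¬ Traceable (Adj s))
    × InP (Adj s) 4 (IsB2 s)
lemma5p1 s 6≤s =
  (critical , no-cut-vertex , not-traceable) ,
  critical , B₂-maximal-clique , two-in-B₂ , γc-set-through-every , critical-pair
  where open Construction s 6≤s
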